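{- For every positive integer $n$, the bistatistic $(\operatorname{veh}',\operatorname{SIVEH})$ has the same joint distribution on $\mathfrak{S}_n$ as $(\operatorname{des},\operatorname{MAJ})$.
   Context: For $\pi=a_1\cdots a_n\in\mathfrak{S}_n$: $\operatorname{Des}(\pi)=\{i\in[n-1]:a_i>a_{i+1}\}$, $\operatorname{des}(\pi)=|\operatorname{Des}(\pi)|$, $\operatorname{MAJ}(\pi)=\sum_{i\in\operatorname{Des}(\pi)}i$. The increasing unordered tree $T'(\pi)$ has root labeled $0$: a letter $b$ that is a right-to-left minimum of $\pi$ is a child of the root; otherwise $b$ is a child of the leftmost letter $a$ to the right of $b$ with $a<b$. $\operatorname{veh}'(\pi)$ is the number of non-root vertices of $T'(\pi)$ at even distance from the root; $\operatorname{EV}(\pi)$ is the set of indices $1\le i\le n$ such that $a_i$ is at even distance from the root; $\operatorname{SIVEH}(\pi)=\sum_{i\in\operatorname{EV}(\pi)}i$. -}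

module Defs where

open import Data.Nat using (ℕ; zero; suc; _+_; _≡ᵇ_; _<ᵇ_; _%_)
open import Data.Bool using (Bool; true; false; if_then_else_; not; _∧_)
open import Data.List using (List; []; _∷_; [_]; map; concatMap; filterᵇ; length; upTo; zip)
open import Data.Bool.ListAction using (any)
open import Data.Nat.ListAction using (sum)
open import Data.Product using (_×_; _,_)

-- A permutation π = a₁⋯aₙ ∈ 𝔖ₙ is represented as the list [a₁, …, aₙ]
-- of natural numbers, a rearrangement of 1,…,n.

words : ℕ → List ℕ → List (List ℕ)
words zero    A = [ [] ]
words (suc k) A = concatMap (λ a → map (a ∷_) (words k A)) A

distinct : List ℕ → Bool
distinct []       = true
distinct (x ∷ xs) = not (any (x ≡ᵇ_) xs) ∧ distinct xs

Sym : ℕ → List (List ℕ)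
Sym n = filterᵇ distinct (words n (map suc (upTo n)))

-- descent positions of a word whose first letter is at position i
desFrom : ℕ → List ℕ → List ℕ
desFrom i []            = []
desFrom i (a ∷ [])      = []
desFrom i (a ∷ b ∷ rest) =
  if b <ᵇ a then i ∷ desFrom (suc i) (b ∷ rest) else desFrom (suc i) (b ∷ rest)

Des : List ℕ → List ℕ
Des π = desFrom 1 π

des : List ℕ → ℕ
des π = length (Des π)

MAJ : List ℕ → ℕ
MAJ π = sum (Des π)

-- parent of b given the letters to its right: the leftmost letter a
-- with a < b, or 0 (the root) if b is a right-to-left minimum.
parent : ℕ → List ℕ → ℕ
parent b []       = 0
parent b (a ∷ as) = if a <ᵇ b then a else parent b as

depthOfLetter : ℕ → List (ℕ × ℕ) → ℕ
depthOfLetter p []             = 0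
depthOfLetter p ((a , d) ∷ xs) = if a ≡ᵇ p then d else depthOfLetter p xs

-- depths π : the distance from the root of each letter of π in T'(π),
-- listed in the order of π
depths : List ℕ → List ℕ
depths []       = []
depths (b ∷ rest) =
  let ds = depths rest
      p  = parent b rest
  in (if p ≡ᵇ 0 then 1 else suc (depthOfLetter p (zip rest ds))) ∷ ds

isEven : ℕ → Bool
isEven d = d % 2 ≡ᵇ 0

-- EV(π): positions i (1-based) such that aᵢ is at even distance from the root
evFrom : ℕ → List ℕ → List ℕ
evFrom i []       = []
evFrom i (d ∷ ds) = if isEven d then i ∷ evFrom (suc i) ds else evFrom (suc i) ds

EV : List ℕ → List ℕ
EV π = evFrom 1 (depths π)

-- veh'(π): number of non-root vertices of T'(π) at even distance from the
-- root (every letter of π is a non-root vertex)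
veh' : List ℕ → ℕ
veh' π = length (filterᵇ isEven (depths π))

SIVEH : List ℕ → ℕ
SIVEH π = sum (EV π)

countJoint : (List ℕ → ℕ) → (List ℕ → ℕ) → ℕ → ℕ → ℕ → ℕ
countJoint s t n k m = length (filterᵇ (λ π → (s π ≡ᵇ k) ∧ (t π ≡ᵇ m)) (Sym n))

{-# OPTIONS --safe #-}
module Submission where

-- Split π = ρ m τ at its least letter m.  In T'(π) the letter m is a child of
-- the root, the letters of ρ with no smaller letter to their right inside ρ
-- become children of m, and τ is untouched; so the depths along π are those
-- of ρ plus one, then 1, then those of τ.  Define Φ(π) = Φ(ρ)ᶜ m Φ(τ), where
-- wᶜ reverses the relative order of the letters of w.  This turns every ascent
-- of Φ(ρ) into a descent and vice versa; moreover the last letter of Φ(ρ)ᶜ is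
-- above m, and m is below its right neighbour.  By induction the positions at
-- even depth in T'(π) are exactly the descents of Φ(π), i.e. EV = Des ∘ Φ, so
-- veh' = des ∘ Φ and SIVEH = MAJ ∘ Φ.  Finally Φ keeps the letters of π and is
-- injective, hence permutes 𝔖ₙ.

open import Defs
open import Data.Bool using (Bool; true; false; T; not; _∧_; if_then_else_)
open import Data.Bool.ListAction using (any)
open import Data.Bool.Properties using (T-∧; T-not-≡; not-involutive)
open import Data.List
  using (List; []; _∷_; _++_; map; length; filterᵇ; upTo; zip; concatMap; cartesianProductWith)
open import Data.List.Extrema.Nat using (min; min≤⊤; min≤xs; argmin-sel)
open import Data.List.Membership.Propositional using (_∈_; _∉_)
open import Data.List.Membership.Propositional.Properties
  using (∈-map⁻; ∈-∃++; ∈-++⁻; ∈-++⁺ˡ; ∈-++⁺ʳ; ∈-filter⁻; ∈-filter⁺;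
         ∈-cartesianProductWith⁺; ∈-cartesianProductWith⁻)
open import Data.List.Properties using (length-map; length-++; length-upTo; ∷-injective; ++-conicalʳ)
open import Data.List.Relation.Binary.Permutation.Propositional
  using (_↭_; ↭-refl; ↭-sym; ↭-trans; ↭-reflexive; ↭⇒↭ₛ; ↭ₛ⇒↭)
import Data.List.Relation.Binary.Permutation.Propositional as ↭
open import Data.List.Relation.Binary.Permutation.Propositional.Properties
  using (∈-resp-↭; All-resp-↭; ↭-length; shift; ++⁺)
import Data.List.Relation.Binary.Permutation.Setoid.Properties as PermutationSetoid
open import Data.List.Relation.Binary.Subset.Propositional using (_⊆_)
open import Data.List.Relation.Unary.All as All using (All; []; _∷_)
import Data.List.Relation.Unary.All.Properties as Allₚ
open import Data.List.Relation.Unary.AllPairs as AllPairs using (AllPairs; []; _∷_)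
import Data.List.Relation.Unary.Any as Any
open import Data.List.Relation.Unary.Any using (here; there)
open import Data.List.Relation.Unary.Any.Properties using (any⁺; any⁻)
open import Data.List.Relation.Unary.Sorted.TotalOrder.Properties
  using (Sorted⇒AllPairs; ↗↭↗⇒≋)
open import Data.List.Relation.Unary.Unique.Propositional using (Unique)
import Data.List.Relation.Unary.Unique.Propositional.Properties as Uniqueₚ
open import Data.List.Relation.Binary.Pointwise using (Pointwise-≡⇒≡)
import Data.List.Sort
open import Data.Maybe using (Maybe; just; nothing)
open import Data.Nat using (ℕ; zero; suc; _+_; _≤_; _<_; _>_; _≡ᵇ_; _<ᵇ_; z<s; s≤s⁻¹)
open import Data.Nat.ListAction using (sum)
open import Data.Nat.Properties
open import Data.Product using (_×_; _,_; proj₁; proj₂; uncurry)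
import Data.Product as Product
open import Data.Sum using (inj₁; inj₂)
open import Function using (_∘_; Equivalence)
open import Level using (0ℓ)
open import Relation.Binary.Bundles using (DecTotalOrder)
open import Relation.Binary.Core using (Rel)
import Relation.Binary.Construct.Flip.EqAndOrd as Flip
open import Relation.Binary.Definitions using (tri<; tri≈; tri>)
open import Relation.Binary.PropositionalEquality
  using (_≡_; _≢_; refl; sym; trans; cong; cong₂; subst; setoid; module ≡-Reasoning)
open import Relation.Binary.Structures using (IsDecTotalOrder)
open import Relation.Nullary using (yes; no; contradiction)
open import Relation.Nullary.Decidable using (dec-true; dec-false; T?)

≡ᵇ-refl : ∀ n → (n ≡ᵇ n) ≡ true
≡ᵇ-refl n = dec-true (n ≟ n) refl

≢⇒≡ᵇ≡false : ∀ {m n} → m ≢ n → (m ≡ᵇ n) ≡ false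
≢⇒≡ᵇ≡false {m} {n} = dec-false (m ≟ n)

<⇒<ᵇ≡true : ∀ {m n} → m < n → (m <ᵇ n) ≡ true
<⇒<ᵇ≡true {m} {n} = dec-true (m <? n)

≥⇒<ᵇ≡false : ∀ {m n} → n ≤ m → (m <ᵇ n) ≡ false
≥⇒<ᵇ≡false {m} {n} = dec-false (m <? n) ∘ ≤⇒≯

above⇒∉ : ∀ {m w} → All (m <_) w → m ∉ w
above⇒∉ m<w m∈w = <-irrefl refl (All.lookup m<w m∈w)

count : {A : Set} → (A → Bool) → List A → ℕ
count p xs = length (filterᵇ p xs)

InjectiveOn : {A B : Set} → (A → B) → List A → Set
InjectiveOn f xs = ∀ {x y} → x ∈ xs → y ∈ xs → f x ≡ f y → x ≡ y

module _ {A : Set} where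

  count-↭ : ∀ p {xs ys : List A} → xs ↭ ys → count p xs ≡ count p ys
  count-↭ p = ↭-length ∘ ↭ₛ⇒↭ ∘ PermutationSetoid.filter⁺ (setoid A) (T? ∘ p) (subst (T ∘ p)) ∘ ↭⇒↭ₛ

  count-map : ∀ {B : Set} p (f : B → A) xs → count p (map f xs) ≡ count (p ∘ f) xs
  count-map p f []       = refl
  count-map p f (x ∷ xs) with p (f x)
  ... | true  = cong suc (count-map p f xs)
  ... | false = count-map p f xs

  count-cong-∈ : ∀ {p q : A → Bool} xs → (∀ {x} → x ∈ xs → p x ≡ q x) → count p xs ≡ count q xs
  count-cong-∈         []       _   = refl
  count-cong-∈ {p} {q} (x ∷ xs) p≗q with p x | q x | p≗q (here refl)
  ... | true  | true  | _ = cong suc (count-cong-∈ xs (p≗q ∘ there))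
  ... | false | false | _ = count-cong-∈ xs (p≗q ∘ there)

  Unique-resp-↭ : ∀ {xs ys : List A} → xs ↭ ys → Unique xs → Unique ys
  Unique-resp-↭ = PermutationSetoid.Unique-resp-↭ (setoid A) ∘ ↭⇒↭ₛ

  Unique-++⁻ : ∀ xs {ys : List A} → Unique (xs ++ ys) → Unique xs × Unique ys
  Unique-++⁻ []       xs!        = [] , xs!
  Unique-++⁻ (x ∷ xs) (x∉ ∷ xs!) = Product.map₁ (Allₚ.++⁻ˡ xs x∉ ∷_) (Unique-++⁻ xs xs!)

  Unique-map⁺ : ∀ {B : Set} {f : A → B} {xs} → Unique xs → InjectiveOn f xs → Unique (map f xs)
  Unique-map⁺ []           _   = []
  Unique-map⁺ (x∉xs ∷ xs!) inj =
    Allₚ.map⁺ (All.tabulate λ y∈xs → All.lookup x∉xs y∈xs ∘ inj (here refl) (there y∈xs))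
      ∷ Unique-map⁺ xs! (λ x∈ y∈ → inj (there x∈) (there y∈))

  map-injectiveOn : ∀ {B : Set} {f : A → B} {zs xs ys} →
                    InjectiveOn f zs → xs ⊆ zs → ys ⊆ zs → map f xs ≡ map f ys → xs ≡ ys
  map-injectiveOn {xs = []}    {[]}    _   _   _   _  = refl
  map-injectiveOn {xs = _ ∷ _} {_ ∷ _} inj xs⊆ ys⊆ eq =
    cong₂ _∷_ (inj (xs⊆ (here refl)) (ys⊆ (here refl)) (proj₁ (∷-injective eq)))
              (map-injectiveOn inj (xs⊆ ∘ there) (ys⊆ ∘ there) (proj₂ (∷-injective eq)))

  ++-∷-cancel : ∀ {m : A} {a a' b b'} → m ∉ a → m ∉ a' → a ++ m ∷ b ≡ a' ++ m ∷ b' → a ≡ a' × b ≡ b'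
  ++-∷-cancel {a = []}    {[]}    _   _    eq = refl , proj₂ (∷-injective eq)
  ++-∷-cancel {a = []}    {_ ∷ _} _   m∉a' eq = contradiction (here (proj₁ (∷-injective eq))) m∉a'
  ++-∷-cancel {a = _ ∷ _} {[]}    m∉a _    eq = contradiction (here (sym (proj₁ (∷-injective eq)))) m∉a
  ++-∷-cancel {a = x ∷ _} {_ ∷ _} m∉a m∉a' eq with ∷-injective eq
  ... | refl , eq' = Product.map₁ (cong (x ∷_)) (++-∷-cancel (m∉a ∘ there) (m∉a' ∘ there) eq')

  unique-⊆-length⇒↭ : ∀ {xs ys : List A} → Unique ys → ys ⊆ xs → length xs ≡ length ys → xs ↭ ys
  unique-⊆-length⇒↭ {[]}    {[]}     _            _     _     = ↭-refl
  unique-⊆-length⇒↭ {_ ∷ _} {[]}     _            _     ()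
  unique-⊆-length⇒↭ {xs}    {y ∷ ys} (y∉ys ∷ ys!) ys⊆xs |xs|≡ with ∈-∃++ (ys⊆xs (here refl))
  ... | as , bs , refl = ↭-trans (shift y as bs) (↭.prep y (unique-⊆-length⇒↭ ys! ys⊆as++bs |as++bs|≡))
    where
    ys⊆as++bs : ys ⊆ as ++ bs
    ys⊆as++bs z∈ys with ∈-++⁻ as (ys⊆xs (there z∈ys))
    ... | inj₁ z∈as         = ∈-++⁺ˡ z∈as
    ... | inj₂ (here refl)  = contradiction refl (All.lookup y∉ys z∈ys)
    ... | inj₂ (there z∈bs) = ∈-++⁺ʳ as z∈bs
    |as++bs|≡ : length (as ++ bs) ≡ length ys
    |as++bs|≡ = suc-injective (trans (sym (↭-length (shift y as bs))) |xs|≡)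

  map-↭ : ∀ {f : A → A} {xs} → Unique xs → (∀ {x} → x ∈ xs → f x ∈ xs) → InjectiveOn f xs → map f xs ↭ xs
  map-↭ {f} {xs} xs! into inj =
    ↭-sym (unique-⊆-length⇒↭ (Unique-map⁺ xs! inj) image⊆xs (sym (length-map f xs)))
    where
    image⊆xs : map f xs ⊆ xs
    image⊆xs fx∈ with ∈-map⁻ f fx∈
    ... | _ , x∈xs , refl = into x∈xs

-- Reversing the order of the letters of a word

module SortedLetters {_≼_ : Rel ℕ 0ℓ} (≼-isDecTotalOrder : IsDecTotalOrder _≡_ _≼_) where

  private
    order : DecTotalOrder 0ℓ 0ℓ 0ℓ
    order = record { isDecTotalOrder = ≼-isDecTotalOrder }
    module Sort = Data.List.Sort order
    open DecTotalOrder order using (totalOrder)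

  open Sort public using (sort; sort-↭)

  sort-strict : ∀ {w} → Unique w → AllPairs (λ x y → x ≼ y × x ≢ y) (sort w)
  sort-strict {w} w! = AllPairs.zip
    (Sorted⇒AllPairs totalOrder (Sort.sort-↗ w) , Unique-resp-↭ (↭-sym (sort-↭ w)) w!)

  sort-cong : ∀ {w w'} → w ↭ w' → sort w ≡ sort w'
  sort-cong {w} {w'} w↭w' = Pointwise-≡⇒≡ (↗↭↗⇒≋ totalOrder (Sort.sort-↗ w) (Sort.sort-↗ w') sort-w↭sort-w')
    where
    sort-w↭sort-w' = ↭⇒↭ₛ (↭-trans (sort-↭ w) (↭-trans w↭w' (↭-sym (sort-↭ w'))))

module Ascending = SortedLetters ≤-isDecTotalOrder
module Descending = SortedLetters (Flip.isDecTotalOrder ≤-isDecTotalOrder)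

ascending descending : List ℕ → List ℕ
ascending  = Ascending.sort
descending = Descending.sort

ascending-strict : ∀ {w} → Unique w → AllPairs _<_ (ascending w)
ascending-strict = AllPairs.map (uncurry ≤∧≢⇒<) ∘ Ascending.sort-strict

descending-strict : ∀ {w} → Unique w → AllPairs _>_ (descending w)
descending-strict = AllPairs.map (λ (y≤x , x≢y) → ≤∧≢⇒< y≤x (x≢y ∘ sym)) ∘ Descending.sort-strict

translate : List ℕ → List ℕ → ℕ → ℕ
translate (a ∷ s) (b ∷ r) x = if a ≡ᵇ x then b else translate s r x
translate _       _       x = x

translate-∈ : ∀ {s r x} → length s ≡ length r → x ∈ s → translate s r x ∈ r
translate-∈ {a ∷ s} {b ∷ r} {x} |s|≡|r| x∈ with a ≟ x
... | yes refl rewrite ≡ᵇ-refl a = here refl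
... | no a≢x rewrite ≢⇒≡ᵇ≡false a≢x =
  there (translate-∈ (suc-injective |s|≡|r|) (Any.tail (a≢x ∘ sym) x∈))

translate-antitone : ∀ {s r x y} → AllPairs _<_ s → AllPairs _>_ r → length s ≡ length r →
                     x ∈ s → y ∈ s → x < y → translate s r y < translate s r x
translate-antitone {a ∷ s} {b ∷ r} {x} {y} (a<s ∷ s<) (b>r ∷ r>) |s|≡|r| x∈ y∈ x<y with a ≟ x | a ≟ y
... | yes refl | yes refl = contradiction x<y (<-irrefl refl)
... | yes refl | no a≢y rewrite ≡ᵇ-refl a | ≢⇒≡ᵇ≡false a≢y =
  All.lookup b>r (translate-∈ (suc-injective |s|≡|r|) (Any.tail (a≢y ∘ sym) y∈))
... | no a≢x   | yes refl = contradiction x<y (<-asym (All.lookup a<s (Any.tail (a≢x ∘ sym) x∈)))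
... | no a≢x   | no a≢y rewrite ≢⇒≡ᵇ≡false a≢x | ≢⇒≡ᵇ≡false a≢y =
  translate-antitone s< r> (suc-injective |s|≡|r|)
    (Any.tail (a≢x ∘ sym) x∈) (Any.tail (a≢y ∘ sym) y∈) x<y

-- sends the i-th smallest letter of w to its i-th largest letter
reflection : List ℕ → ℕ → ℕ
reflection w = translate (ascending w) (descending w)

complement : List ℕ → List ℕ
complement w = map (reflection w) w

module _ {w : List ℕ} where

  private
    |ascending|≡|descending| : length (ascending w) ≡ length (descending w)
    |ascending|≡|descending| =
      trans (↭-length (Ascending.sort-↭ w)) (sym (↭-length (Descending.sort-↭ w)))

    ∈-ascending : ∀ {x} → x ∈ w → x ∈ ascending w
    ∈-ascending = ∈-resp-↭ (↭-sym (Ascending.sort-↭ w))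

  reflection-∈ : ∀ {x} → x ∈ w → reflection w x ∈ w
  reflection-∈ = ∈-resp-↭ (Descending.sort-↭ w) ∘ translate-∈ |ascending|≡|descending| ∘ ∈-ascending

  reflection-antitone : Unique w → ∀ {x y} → x ∈ w → y ∈ w → x < y → reflection w y < reflection w x
  reflection-antitone w! x∈ y∈ = translate-antitone (ascending-strict w!) (descending-strict w!)
    |ascending|≡|descending| (∈-ascending x∈) (∈-ascending y∈)

  reflection-injective : Unique w → InjectiveOn (reflection w) w
  reflection-injective w! {x} {y} x∈ y∈ eq with <-cmp x y
  ... | tri< x<y _ _ = contradiction (sym eq) (<⇒≢ (reflection-antitone w! x∈ y∈ x<y))
  ... | tri≈ _ x≡y _ = x≡y
  ... | tri> _ _ y<x = contradiction eq (<⇒≢ (reflection-antitone w! y∈ x∈ y<x))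

  complement-↭ : Unique w → complement w ↭ w
  complement-↭ w! = map-↭ w! reflection-∈ (reflection-injective w!)

complement-injective : ∀ {w w'} → Unique w → Unique w' → complement w ≡ complement w' → w ≡ w'
complement-injective {w} {w'} w! w'! eq =
  map-injectiveOn (reflection-injective w!) (λ x∈w → x∈w) (∈-resp-↭ (↭-sym w↭w')) (trans eq same-reflection)
  where
  w↭w' : w ↭ w'
  w↭w' = ↭-trans (↭-sym (complement-↭ w!)) (subst (_↭ w') (sym eq) (complement-↭ w'!))
  same-reflection : map (reflection w') w' ≡ map (reflection w) w'
  same-reflection = cong (λ f → map f w')
    (cong₂ translate (Ascending.sort-cong (↭-sym w↭w')) (Descending.sort-cong (↭-sym w↭w')))

-- Entry i tells whether position i of w is a descent, where `next` is the
-- letter following w, if any; without one the last position is no descent.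
descentBits : Maybe ℕ → List ℕ → List Bool
descentBits next     []          = []
descentBits next     (a ∷ b ∷ w) = (b <ᵇ a) ∷ descentBits next (b ∷ w)
descentBits nothing  (a ∷ [])    = false ∷ []
descentBits (just n) (a ∷ [])    = (n <ᵇ a) ∷ []

descentBits-++ : ∀ next u m v →
                 descentBits next (u ++ m ∷ v) ≡ descentBits (just m) u ++ descentBits next (m ∷ v)
descentBits-++ next []          m v = refl
descentBits-++ next (a ∷ [])    m v = refl
descentBits-++ next (a ∷ b ∷ u) m v = cong ((b <ᵇ a) ∷_) (descentBits-++ next (b ∷ u) m v)

descentBits-least : ∀ {m} v → All (m <_) v → descentBits nothing (m ∷ v) ≡ false ∷ descentBits nothing v
descentBits-least []      _           = refl
descentBits-least (b ∷ v) (m<b ∷ _) rewrite ≥⇒<ᵇ≡false (<⇒≤ m<b) = refl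

descentBits-antitone : ∀ {f : ℕ → ℕ} {m} w → Unique w →
                       (∀ {x y} → x ∈ w → y ∈ w → x < y → f y < f x) → (∀ {x} → x ∈ w → m < f x) →
                       descentBits (just m) (map f w) ≡ map not (descentBits nothing w)
descentBits-antitone     []          _                 _    _   = refl
descentBits-antitone     (a ∷ [])    _                 _    m<f = cong (_∷ []) (<⇒<ᵇ≡true (m<f (here refl)))
descentBits-antitone {f} (a ∷ b ∷ w) ((a≢b ∷ _) ∷ bw!) anti m<f =
  cong₂ _∷_ flipped (descentBits-antitone (b ∷ w) bw! (λ x∈ y∈ → anti (there x∈) (there y∈)) (m<f ∘ there))
  where
  flipped : (f b <ᵇ f a) ≡ not (b <ᵇ a)
  flipped with <-cmp a b
  ... | tri< a<b _ _ rewrite <⇒<ᵇ≡true (anti (here refl) (there (here refl)) a<b)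
                           | ≥⇒<ᵇ≡false (<⇒≤ a<b) = refl
  ... | tri≈ _ a≡b _ = contradiction a≡b a≢b
  ... | tri> _ _ b<a rewrite ≥⇒<ᵇ≡false (<⇒≤ (anti (there (here refl)) (here refl) b<a))
                           | <⇒<ᵇ≡true b<a = refl

descentBits-complement : ∀ {m w} → Unique w → All (m <_) w →
                         descentBits (just m) (complement w) ≡ map not (descentBits nothing w)
descentBits-complement {w = w} w! m<w =
  descentBits-antitone w w! (reflection-antitone w!) (All.lookup m<w ∘ reflection-∈)

trueIndicesFrom : ℕ → List Bool → List ℕ
trueIndicesFrom i []       = []
trueIndicesFrom i (b ∷ bs) =
  if b then i ∷ trueIndicesFrom (suc i) bs else trueIndicesFrom (suc i) bs

desFrom≡trueIndicesFrom : ∀ i w → desFrom i w ≡ trueIndicesFrom i (descentBits nothing w)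
desFrom≡trueIndicesFrom i []          = refl
desFrom≡trueIndicesFrom i (a ∷ [])    = refl
desFrom≡trueIndicesFrom i (a ∷ b ∷ w) rewrite desFrom≡trueIndicesFrom (suc i) (b ∷ w) = refl

evFrom≡trueIndicesFrom : ∀ i ds → evFrom i ds ≡ trueIndicesFrom i (map isEven ds)
evFrom≡trueIndicesFrom i []       = refl
evFrom≡trueIndicesFrom i (d ∷ ds) rewrite evFrom≡trueIndicesFrom (suc i) ds = refl

length-evFrom : ∀ i ds → length (evFrom i ds) ≡ length (filterᵇ isEven ds)
length-evFrom i []       = refl
length-evFrom i (d ∷ ds) with isEven d
... | true  = cong suc (length-evFrom (suc i) ds)
... | false = length-evFrom (suc i) ds

-- Depths in T'(π)

isEven-suc : ∀ d → isEven (suc d) ≡ not (isEven d)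
isEven-suc zero    = refl
isEven-suc (suc d) rewrite isEven-suc d = sym (not-involutive _)

map-isEven-suc-++ : ∀ ds ds' →
                    map isEven (map suc ds ++ 1 ∷ ds') ≡ map not (map isEven ds) ++ false ∷ map isEven ds'
map-isEven-suc-++ []       ds' = refl
map-isEven-suc-++ (d ∷ ds) ds' = cong₂ _∷_ (isEven-suc d) (map-isEven-suc-++ ds ds')

parent-above : ∀ {b} τ → All (b ≤_) τ → parent b τ ≡ 0
parent-above []      _           = refl
parent-above (a ∷ τ) (b≤a ∷ b≤τ) rewrite ≥⇒<ᵇ≡false b≤a = parent-above τ b≤τ

parent-∈ : ∀ {b q} ρ → parent b ρ ≡ suc q → suc q ∈ ρ
parent-∈ {b} (a ∷ ρ) eq with a <ᵇ b
... | true  = here (sym eq)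
... | false = there (parent-∈ ρ eq)

parent-++ : ∀ {b q} ρ σ → parent b ρ ≡ suc q → parent b (ρ ++ σ) ≡ suc q
parent-++ {b} (a ∷ ρ) σ eq with a <ᵇ b
... | true  = eq
... | false = parent-++ ρ σ eq

-- 0 doubles as "no parent", hence the positivity of ρ
parent-++-least : ∀ {b m} ρ τ → All (0 <_) ρ → parent b ρ ≡ 0 → m < b → parent b (ρ ++ m ∷ τ) ≡ m
parent-++-least {b} []      τ _              _  m<b rewrite <⇒<ᵇ≡true m<b = refl
parent-++-least {b} (a ∷ ρ) τ (0<a ∷ 0<ρ) eq m<b with a <ᵇ b
... | true  = contradiction (sym eq) (<⇒≢ 0<a)
... | false = parent-++-least ρ τ 0<ρ eq m<b

depthOfLetter-++ : ∀ {p A ds} X Y → p ∈ A → length ds ≡ length A →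
                   depthOfLetter p (zip (A ++ X) (ds ++ Y)) ≡ depthOfLetter p (zip A ds)
depthOfLetter-++ {p} {a ∷ A} {d ∷ ds} X Y (here refl) _ rewrite ≡ᵇ-refl p = refl
depthOfLetter-++ {p} {a ∷ A} {d ∷ ds} X Y (there p∈A) |ds|≡ with a ≡ᵇ p
... | true  = refl
... | false = depthOfLetter-++ X Y p∈A (suc-injective |ds|≡)

depthOfLetter-map-suc : ∀ {p A ds} → p ∈ A → length ds ≡ length A →
                        depthOfLetter p (zip A (map suc ds)) ≡ suc (depthOfLetter p (zip A ds))
depthOfLetter-map-suc {p} {a ∷ A} {d ∷ ds} (here refl) _ rewrite ≡ᵇ-refl p = refl
depthOfLetter-map-suc {p} {a ∷ A} {d ∷ ds} (there p∈A) |ds|≡ with a ≡ᵇ p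
... | true  = refl
... | false = depthOfLetter-map-suc p∈A (suc-injective |ds|≡)

depthOfLetter-after : ∀ {p A ds} d X Y → p ∉ A → length ds ≡ length A →
                      depthOfLetter p (zip (A ++ p ∷ X) (ds ++ d ∷ Y)) ≡ d
depthOfLetter-after {p} {[]}    {[]}     d X Y _   _ rewrite ≡ᵇ-refl p = refl
depthOfLetter-after {p} {a ∷ A} {_ ∷ ds} d X Y p∉A |ds|≡ rewrite ≢⇒≡ᵇ≡false (p∉A ∘ here ∘ sym) =
  depthOfLetter-after d X Y (p∉A ∘ there) (suc-injective |ds|≡)

length-depths : ∀ π → length (depths π) ≡ length π
length-depths []      = refl
length-depths (_ ∷ π) = cong suc (length-depths π)

length-map-suc-depths : ∀ π → length (map suc (depths π)) ≡ length π
length-map-suc-depths π = trans (length-map suc (depths π)) (length-depths π)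

-- the head of depths (b ∷ rest) when p = parent b rest and ds = depths rest
depthBelow : ℕ → List ℕ → List ℕ → ℕ
depthBelow p rest ds = if p ≡ᵇ 0 then 1 else suc (depthOfLetter p (zip rest ds))

depthBelow-least : ∀ {b m} ρ τ dτ → 0 < m → All (m <_) ρ → m < b →
                   depthBelow (parent b (ρ ++ m ∷ τ)) (ρ ++ m ∷ τ) (map suc (depths ρ) ++ 1 ∷ dτ)
                   ≡ suc (depthBelow (parent b ρ) ρ (depths ρ))
depthBelow-least {b} {suc m} ρ τ dτ 0<m m<ρ m<b with parent b ρ in eq
... | zero  =
  trans (cong (λ p → depthBelow p (ρ ++ suc m ∷ τ) (map suc (depths ρ) ++ 1 ∷ dτ))
              (parent-++-least ρ τ (All.map (<-trans 0<m) m<ρ) eq m<b))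
        (cong suc (depthOfLetter-after 1 τ dτ (above⇒∉ m<ρ) (length-map-suc-depths ρ)))
... | suc q =
  trans (cong (λ p → depthBelow p (ρ ++ suc m ∷ τ) (map suc (depths ρ) ++ 1 ∷ dτ))
              (parent-++ ρ (suc m ∷ τ) eq))
        (cong suc (trans (depthOfLetter-++ (suc m ∷ τ) (1 ∷ dτ) (parent-∈ ρ eq) (length-map-suc-depths ρ))
                         (depthOfLetter-map-suc (parent-∈ ρ eq) (length-depths ρ))))

depths-least : ∀ {m} ρ τ → 0 < m → All (m <_) ρ → All (m <_) τ →
               depths (ρ ++ m ∷ τ) ≡ map suc (depths ρ) ++ 1 ∷ depths τ
depths-least []      τ _   _            m<τ rewrite parent-above τ (All.map <⇒≤ m<τ) = refl
depths-least (b ∷ ρ) τ 0<m (m<b ∷ m<ρ) m<τ rewrite depths-least ρ τ 0<m m<ρ m<τ =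
  cong (_∷ _) (depthBelow-least ρ τ (depths τ) 0<m m<ρ m<b)

-- The bijection Φ

before : ℕ → List ℕ → List ℕ
before m []       = []
before m (x ∷ xs) = if x ≡ᵇ m then [] else x ∷ before m xs

after : ℕ → List ℕ → List ℕ
after m []       = []
after m (x ∷ xs) = if x ≡ᵇ m then xs else after m xs

before-after : ∀ {m π} → m ∈ π → π ≡ before m π ++ m ∷ after m π
before-after {m} {x ∷ xs} m∈ with x ≟ m | m∈
... | yes refl | _          rewrite ≡ᵇ-refl x = refl
... | no x≢m   | here refl  = contradiction refl x≢m
... | no x≢m   | there m∈xs rewrite ≢⇒≡ᵇ≡false x≢m = cong (x ∷_) (before-after m∈xs)

min-∈ : ∀ x xs → min x xs ∈ x ∷ xs
min-∈ x xs with argmin-sel (λ y → y) x xs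
... | inj₁ min≡x  = here min≡x
... | inj₂ min∈xs = there min∈xs

min-≤ : ∀ x xs → All (min x xs ≤_) (x ∷ xs)
min-≤ x xs = min≤⊤ x xs ∷ min≤xs x xs

module LeastSplit (x : ℕ) (xs : List ℕ) where

  m : ℕ
  m = min x xs

  ρ τ : List ℕ
  ρ = before m (x ∷ xs)
  τ = after m (x ∷ xs)

  split : x ∷ xs ≡ ρ ++ m ∷ τ
  split = before-after (min-∈ x xs)

  least-first : x ∷ xs ↭ m ∷ ρ ++ τ
  least-first = subst (_↭ m ∷ ρ ++ τ) (sym split) (shift m ρ τ)

  parts : ∀ {P : ℕ → Set} → All P (x ∷ xs) → P m × All P ρ × All P τ
  parts Pπ with All-resp-↭ least-first Pπ
  ... | Pm ∷ Pρτ = Pm , Allₚ.++⁻ ρ Pρτ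

  shorter : ∀ {f} → length (x ∷ xs) ≤ suc f → length ρ ≤ f × length τ ≤ f
  shorter {f} |π|≤ = ≤-trans (m≤m+n _ _) |ρ|+|τ|≤ , ≤-trans (m≤n+m _ _) |ρ|+|τ|≤
    where
    |ρ|+|τ|≤ : length ρ + length τ ≤ f
    |ρ|+|τ|≤ = s≤s⁻¹ (subst (_≤ suc f) (trans (↭-length least-first) (cong suc (length-++ ρ))) |π|≤)

  module _ (π! : Unique (x ∷ xs)) where

    private
      m∷ρ++τ! : Unique (m ∷ ρ ++ τ)
      m∷ρ++τ! = Unique-resp-↭ least-first π!

      ρ++τ! : Unique (ρ ++ τ)
      ρ++τ! = AllPairs.tail m∷ρ++τ!

      m<ρ++τ : All (m <_) (ρ ++ τ)
      m<ρ++τ = All.zipWith (uncurry ≤∧≢⇒<)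
        (All.tail (All-resp-↭ least-first (min-≤ x xs)) , AllPairs.head m∷ρ++τ!)

    ρ-unique : Unique ρ
    ρ-unique = proj₁ (Unique-++⁻ ρ ρ++τ!)

    τ-unique : Unique τ
    τ-unique = proj₂ (Unique-++⁻ ρ ρ++τ!)

    ρ-above : All (m <_) ρ
    ρ-above = Allₚ.++⁻ˡ ρ m<ρ++τ

    τ-above : All (m <_) τ
    τ-above = Allₚ.++⁻ʳ ρ m<ρ++τ

-- The first argument is fuel: Φ f π is the full recursion once length π ≤ f.
Φ : ℕ → List ℕ → List ℕ
Φ zero    π        = π
Φ (suc f) []       = []
Φ (suc f) (x ∷ xs) = complement (Φ f ρ) ++ m ∷ Φ f τ
  where open LeastSplit x xs

Φ-↭ : ∀ f {π} → Unique π → Φ f π ↭ π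
Φ-↭ zero               _  = ↭-refl
Φ-↭ (suc f) {[]}     _  = ↭-refl
Φ-↭ (suc f) {x ∷ xs} π! =
  ↭-trans (++⁺ (↭-trans (complement-↭ Φρ!) Φρ↭ρ) (↭.prep m (Φ-↭ f (τ-unique π!))))
          (↭-reflexive (sym split))
  where
  open LeastSplit x xs
  Φρ↭ρ : Φ f ρ ↭ ρ
  Φρ↭ρ = Φ-↭ f (ρ-unique π!)
  Φρ! : Unique (Φ f ρ)
  Φρ! = Unique-resp-↭ (↭-sym Φρ↭ρ) (ρ-unique π!)

Φ-unique : ∀ f {π} → Unique π → Unique (Φ f π)
Φ-unique f π! = Unique-resp-↭ (↭-sym (Φ-↭ f π!)) π!

Φ-All : ∀ f {P : ℕ → Set} {π} → Unique π → All P π → All P (Φ f π)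
Φ-All f π! = All-resp-↭ (↭-sym (Φ-↭ f π!))

complement-All : ∀ {P : ℕ → Set} {w} → Unique w → All P w → All P (complement w)
complement-All w! = All-resp-↭ (↭-sym (complement-↭ w!))

least-∉-complement-Φ : ∀ f {x xs} → Unique (x ∷ xs) →
                       LeastSplit.m x xs ∉ complement (Φ f (LeastSplit.ρ x xs))
least-∉-complement-Φ f {x} {xs} π! =
  above⇒∉ (complement-All (Φ-unique f (ρ-unique π!)) (Φ-All f (ρ-unique π!) (ρ-above π!)))
  where open LeastSplit x xs

Φ-nonempty : ∀ f x xs → Φ (suc f) (x ∷ xs) ≢ []
Φ-nonempty f x xs eq = contradiction (++-conicalʳ (complement (Φ f ρ)) (m ∷ Φ f τ) eq) λ ()
  where open LeastSplit x xs

Φ-injective : ∀ f {π π'} → length π ≤ f → length π' ≤ f → Unique π → Unique π' →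
              Φ f π ≡ Φ f π' → π ≡ π'
Φ-injective zero                          _    _     _  _   eq = eq
Φ-injective (suc f) {[]}     {[]}         _    _     _  _   _  = refl
Φ-injective (suc f) {[]}     {x' ∷ xs'}   _    _     _  _   eq = contradiction (sym eq) (Φ-nonempty f x' xs')
Φ-injective (suc f) {x ∷ xs} {[]}         _    _     _  _   eq = contradiction eq (Φ-nonempty f x xs)
Φ-injective (suc f) {x ∷ xs} {x' ∷ xs'} |π|≤ |π'|≤ π! π'! eq = begin
  x ∷ xs              ≡⟨ L.split ⟩
  L.ρ ++ L.m ∷ L.τ    ≡⟨ cong₂ _++_ ρ≡ρ' (cong₂ _∷_ m≡m' τ≡τ') ⟩
  L'.ρ ++ L'.m ∷ L'.τ ≡⟨ L'.split ⟨
  x' ∷ xs'            ∎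
  where
  open ≡-Reasoning
  module L  = LeastSplit x xs
  module L' = LeastSplit x' xs'

  π⊆π' : (x ∷ xs) ⊆ (x' ∷ xs')
  π⊆π' = ∈-resp-↭ (Φ-↭ (suc f) π'!) ∘ subst (_ ∈_) eq ∘ ∈-resp-↭ (↭-sym (Φ-↭ (suc f) π!))
  π'⊆π : (x' ∷ xs') ⊆ (x ∷ xs)
  π'⊆π = ∈-resp-↭ (Φ-↭ (suc f) π!) ∘ subst (_ ∈_) (sym eq) ∘ ∈-resp-↭ (↭-sym (Φ-↭ (suc f) π'!))

  m≡m' : L.m ≡ L'.m
  m≡m' = ≤-antisym (All.lookup (min-≤ x xs) (π'⊆π (min-∈ x' xs')))
                   (All.lookup (min-≤ x' xs') (π⊆π' (min-∈ x xs)))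

  pieces : complement (Φ f L.ρ) ≡ complement (Φ f L'.ρ) × Φ f L.τ ≡ Φ f L'.τ
  pieces = ++-∷-cancel (least-∉-complement-Φ f π!)
                       (subst (_∉ _) (sym m≡m') (least-∉-complement-Φ f π'!))
                       (subst (λ k → _ ≡ complement (Φ f L'.ρ) ++ k ∷ Φ f L'.τ) (sym m≡m') eq)

  ρ≡ρ' : L.ρ ≡ L'.ρ
  ρ≡ρ' = Φ-injective f (proj₁ (L.shorter |π|≤)) (proj₁ (L'.shorter |π'|≤)) (L.ρ-unique π!) (L'.ρ-unique π'!)
           (complement-injective (Φ-unique f (L.ρ-unique π!)) (Φ-unique f (L'.ρ-unique π'!)) (proj₁ pieces))

  τ≡τ' : L.τ ≡ L'.τ
  τ≡τ' = Φ-injective f (proj₂ (L.shorter |π|≤)) (proj₂ (L'.shorter |π'|≤)) (L.τ-unique π!) (L'.τ-unique π'!)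
           (proj₂ pieces)

-- EV = Des ∘ Φ

parities≡descentBits-Φ : ∀ f {π} → length π ≤ f → Unique π → All (0 <_) π →
                         map isEven (depths π) ≡ descentBits nothing (Φ f π)
parities≡descentBits-Φ zero    {[]}     _    _  _   = refl
parities≡descentBits-Φ (suc f) {[]}     _    _  _   = refl
parities≡descentBits-Φ (suc f) {x ∷ xs} |π|≤ π! 0<π = begin
  map isEven (depths (x ∷ xs))
    ≡⟨ cong (map isEven ∘ depths) split ⟩
  map isEven (depths (ρ ++ m ∷ τ))
    ≡⟨ cong (map isEven) (depths-least ρ τ 0<m (ρ-above π!) (τ-above π!)) ⟩
  map isEven (map suc (depths ρ) ++ 1 ∷ depths τ)
    ≡⟨ map-isEven-suc-++ (depths ρ) (depths τ) ⟩
  map not (map isEven (depths ρ)) ++ false ∷ map isEven (depths τ)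
    ≡⟨ cong₂ (λ bs bs' → map not bs ++ false ∷ bs')
             (parities≡descentBits-Φ f |ρ|≤ (ρ-unique π!) 0<ρ)
             (parities≡descentBits-Φ f |τ|≤ (τ-unique π!) 0<τ) ⟩
  map not (descentBits nothing (Φ f ρ)) ++ false ∷ descentBits nothing (Φ f τ)
    ≡⟨ cong₂ _++_
         (descentBits-complement (Φ-unique f (ρ-unique π!)) (Φ-All f (ρ-unique π!) (ρ-above π!)))
         (descentBits-least (Φ f τ) (Φ-All f (τ-unique π!) (τ-above π!))) ⟨
  descentBits (just m) (complement (Φ f ρ)) ++ descentBits nothing (m ∷ Φ f τ)
    ≡⟨ descentBits-++ nothing (complement (Φ f ρ)) m (Φ f τ) ⟨
  descentBits nothing (Φ (suc f) (x ∷ xs))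
    ∎
  where
  open ≡-Reasoning
  open LeastSplit x xs
  |ρ|≤ : length ρ ≤ f
  |ρ|≤ = proj₁ (shorter |π|≤)
  |τ|≤ : length τ ≤ f
  |τ|≤ = proj₂ (shorter |π|≤)
  0<m : 0 < m
  0<m = proj₁ (parts 0<π)
  0<ρ : All (0 <_) ρ
  0<ρ = proj₁ (proj₂ (parts 0<π))
  0<τ : All (0 <_) τ
  0<τ = proj₂ (proj₂ (parts 0<π))

module _ {f π} (|π|≤ : length π ≤ f) (π! : Unique π) (0<π : All (0 <_) π) where

  EV≡Des-Φ : EV π ≡ Des (Φ f π)
  EV≡Des-Φ = begin
    evFrom 1 (depths π)
      ≡⟨ evFrom≡trueIndicesFrom 1 (depths π) ⟩
    trueIndicesFrom 1 (map isEven (depths π))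
      ≡⟨ cong (trueIndicesFrom 1) (parities≡descentBits-Φ f |π|≤ π! 0<π) ⟩
    trueIndicesFrom 1 (descentBits nothing (Φ f π))
      ≡⟨ desFrom≡trueIndicesFrom 1 (Φ f π) ⟨
    desFrom 1 (Φ f π)
      ∎
    where open ≡-Reasoning

  veh'≡des-Φ : veh' π ≡ des (Φ f π)
  veh'≡des-Φ = trans (sym (length-evFrom 1 (depths π))) (cong length EV≡Des-Φ)

  SIVEH≡MAJ-Φ : SIVEH π ≡ MAJ (Φ f π)
  SIVEH≡MAJ-Φ = cong sum EV≡Des-Φ

words-suc : ∀ k A → words (suc k) A ≡ cartesianProductWith _∷_ A (words k A)
words-suc k A = concatMap-∷ A
  where
  concatMap-∷ : ∀ B → concatMap (λ a → map (a ∷_) (words k A)) B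
                      ≡ cartesianProductWith _∷_ B (words k A)
  concatMap-∷ []      = refl
  concatMap-∷ (b ∷ B) = cong (map (b ∷_) (words k A) ++_) (concatMap-∷ B)

∈-words⁻ : ∀ k {A π} → π ∈ words k A → length π ≡ k × All (_∈ A) π
∈-words⁻ zero    (here refl) = refl , []
∈-words⁻ (suc k) {A} π∈
  with ∈-cartesianProductWith⁻ _∷_ A (words k A) (subst (_ ∈_) (words-suc k A) π∈)
... | _ , _ , a∈A , w∈ , refl = Product.map (cong suc) (a∈A ∷_) (∈-words⁻ k w∈)

∈-words⁺ : ∀ {A} π → All (_∈ A) π → π ∈ words (length π) A
∈-words⁺     []      []           = here refl
∈-words⁺ {A} (a ∷ π) (a∈A ∷ π⊆A) =
  subst (_ ∈_) (sym (words-suc (length π) A)) (∈-cartesianProductWith⁺ _∷_ a∈A (∈-words⁺ π π⊆A))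

words-unique : ∀ k {A} → Unique A → Unique (words k A)
words-unique zero    _  = [] ∷ []
words-unique (suc k) {A} A! =
  subst Unique (sym (words-suc k A))
        (Uniqueₚ.cartesianProductWith⁺ _∷_ ∷-injective A! (words-unique k A!))

any-≡ᵇ⁺ : ∀ {x xs} → x ∈ xs → T (any (x ≡ᵇ_) xs)
any-≡ᵇ⁺ {x} = any⁺ _ ∘ Any.map (λ { refl → ≡⇒≡ᵇ x x refl })

any-≡ᵇ⁻ : ∀ {x xs} → T (any (x ≡ᵇ_) xs) → x ∈ xs
any-≡ᵇ⁻ {x} {xs} = Any.map (≡ᵇ⇒≡ x _) ∘ any⁻ _ xs

distinct⇒Unique : ∀ π → T (distinct π) → Unique π
distinct⇒Unique []       _ = []
distinct⇒Unique (x ∷ xs) h with Equivalence.to T-∧ h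
... | fresh , xs-distinct =
  Allₚ.¬Any⇒All¬ xs (λ x∈xs → subst T (Equivalence.to T-not-≡ fresh) (any-≡ᵇ⁺ x∈xs))
    ∷ distinct⇒Unique xs xs-distinct

Unique⇒distinct : ∀ {π} → Unique π → T (distinct π)
Unique⇒distinct          []           = _
Unique⇒distinct {x ∷ xs} (x∉xs ∷ xs!) = Equivalence.from T-∧ (fresh , Unique⇒distinct xs!)
  where
  fresh : T (not (any (x ≡ᵇ_) xs))
  fresh with any (x ≡ᵇ_) xs in eq
  ... | false = _
  ... | true  = contradiction refl (All.lookup x∉xs (any-≡ᵇ⁻ (subst T (sym eq) _)))

alphabet : ℕ → List ℕ
alphabet n = map suc (upTo n)

length-alphabet : ∀ n → length (alphabet n) ≡ n
length-alphabet n = trans (length-map suc (upTo n)) (length-upTo n)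

alphabet-unique : ∀ n → Unique (alphabet n)
alphabet-unique n = Uniqueₚ.map⁺ suc-injective (Uniqueₚ.upTo⁺ n)

alphabet-positive : ∀ n → All (0 <_) (alphabet n)
alphabet-positive n = Allₚ.map⁺ (All.tabulate (λ _ → z<s))

∈-Sym⁻ : ∀ n {π} → π ∈ Sym n → π ↭ alphabet n
∈-Sym⁻ n {π} π∈ with ∈-filter⁻ (T? ∘ distinct) {xs = words n (alphabet n)} π∈
... | π∈words , π-distinct with ∈-words⁻ n π∈words
... | |π|≡n , π⊆ = ↭-sym (unique-⊆-length⇒↭ (distinct⇒Unique π π-distinct) (All.lookup π⊆)
                           (trans (length-alphabet n) (sym |π|≡n)))

∈-Sym⁺ : ∀ n {π} → π ↭ alphabet n → π ∈ Sym n
∈-Sym⁺ n {π} π↭ = ∈-filter⁺ (T? ∘ distinct)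
  (subst (λ k → π ∈ words k (alphabet n)) (trans (↭-length π↭) (length-alphabet n))
         (∈-words⁺ π (All.tabulate (∈-resp-↭ π↭))))
  (Unique⇒distinct (Unique-resp-↭ (↭-sym π↭) (alphabet-unique n)))

Sym-unique : ∀ n → Unique (Sym n)
Sym-unique n = Uniqueₚ.filter⁺ (T? ∘ distinct) (words-unique n (alphabet-unique n))

module _ (n : ℕ) {π} (π∈ : π ∈ Sym n) where

  ∈-Sym⇒length : length π ≤ n
  ∈-Sym⇒length = ≤-reflexive (trans (↭-length (∈-Sym⁻ n π∈)) (length-alphabet n))

  ∈-Sym⇒unique : Unique π
  ∈-Sym⇒unique = Unique-resp-↭ (↭-sym (∈-Sym⁻ n π∈)) (alphabet-unique n)

  ∈-Sym⇒positive : All (0 <_) π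
  ∈-Sym⇒positive = All-resp-↭ (↭-sym (∈-Sym⁻ n π∈)) (alphabet-positive n)

Φ-permutes-Sym : ∀ n → map (Φ n) (Sym n) ↭ Sym n
Φ-permutes-Sym n = map-↭ (Sym-unique n) Φ-∈-Sym Φ-injectiveOn-Sym
  where
  Φ-∈-Sym : ∀ {π} → π ∈ Sym n → Φ n π ∈ Sym n
  Φ-∈-Sym π∈ = ∈-Sym⁺ n (↭-trans (Φ-↭ n (∈-Sym⇒unique n π∈)) (∈-Sym⁻ n π∈))
  Φ-injectiveOn-Sym : InjectiveOn (Φ n) (Sym n)
  Φ-injectiveOn-Sym π∈ π'∈ =
    Φ-injective n (∈-Sym⇒length n π∈) (∈-Sym⇒length n π'∈) (∈-Sym⇒unique n π∈) (∈-Sym⇒unique n π'∈)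

corollary8p2 : (n : ℕ) → 1 ≤ n → (k m : ℕ) →
    countJoint veh' SIVEH n k m ≡ countJoint des MAJ n k m
corollary8p2 n _ k m = begin
  count (λ π → (veh' π ≡ᵇ k) ∧ (SIVEH π ≡ᵇ m)) (Sym n) ≡⟨ count-cong-∈ (Sym n) same-statistics ⟩
  count (desMaj ∘ Φ n) (Sym n)                          ≡⟨ count-map desMaj (Φ n) (Sym n) ⟨
  count desMaj (map (Φ n) (Sym n))                      ≡⟨ count-↭ desMaj (Φ-permutes-Sym n) ⟩
  count desMaj (Sym n)                                  ∎
  where
  open ≡-Reasoning
  desMaj : List ℕ → Bool
  desMaj π = (des π ≡ᵇ k) ∧ (MAJ π ≡ᵇ m)
  same-statistics : ∀ {π} → π ∈ Sym n → (veh' π ≡ᵇ k) ∧ (SIVEH π ≡ᵇ m) ≡ desMaj (Φ n π)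
  same-statistics π∈ = cong₂ (λ a b → (a ≡ᵇ k) ∧ (b ≡ᵇ m))
    (veh'≡des-Φ (∈-Sym⇒length n π∈) (∈-Sym⇒unique n π∈) (∈-Sym⇒positive n π∈))
    (SIVEH≡MAJ-Φ (∈-Sym⇒length n π∈) (∈-Sym⇒unique n π∈) (∈-Sym⇒positive n π∈))
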